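{- Let $G$ be a connected proper interval graph on vertices $1,\dots,n$, labeled in increasing order of left endpoints of a proper interval representation $I_v=[\ell_v,r_v]$ with distinct endpoints in $[2n]$. For each vertex $v$ let $s_v=\min\{w:\ell_v\in I_w\}$, and let $T$ be the ordinal tree with root $1$ obtained by processing $v=2,\dots,n$ in increasing order and attaching $v$ as the new rightmost child of $s_v$. Let $v$ be a vertex and let $u_2$ be the largest vertex in the closed neighborhood of $v$. If $v$ is a leaf of $T$, then $u_2=\mathrm{last\_child}(\mathrm{prev\_internal}(v))$; otherwise $u_2=\mathrm{last\_child}(v)$.
   Context: A proper interval graph is an interval graph admitting an interval representation with no interval properly contained in another. The closed neighborhood of $v$ consists of $v$ and its neighbors. In $T$, $\mathrm{last\_child}(x)$ denotes the rightmost child of node $x$, and $\mathrm{prev\_internal}(v)$ denotes the last internal (non-leaf) node before $v$ in the left-to-right breadth-first (level-order) traversal of $T$. Tree nodes are identified with the corresponding graph vertices. -}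

module Defs where

open import Data.Nat using (ℕ; zero; suc; _+_; _*_; _≤_; _<_; _≤ᵇ_)
open import Data.Fin as Fin using (Fin; zero; suc; toℕ)
open import Data.Bool using (Bool; true; false; if_then_else_; _∧_; not)
open import Data.Maybe using (Maybe; just; nothing; _>>=_)
import Data.Maybe as Maybe
open import Data.List using (List; []; _∷_; _++_; filterᵇ; takeWhileᵇ; last; allFin)
open import Data.Product using (_×_; Σ)
open import Relation.Nullary using (¬_; does)
open import Relation.Binary.PropositionalEquality using (_≡_; _≢_)

-- A family of closed intervals I_v = [ℓ v , r v] indexed by vertices Fin n
-- (vertex labels 0..n-1 stand for the paper's 1..n).
record Intervals (n : ℕ) : Set where
  constructor intervals
  field
    ℓ : Fin n → ℕ
    r : Fin n → ℕ
open Intervals public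

record IsLabeledProperRep {n : ℕ} (I : Intervals n) : Set where
  field
    ℓ<r        : ∀ v → ℓ I v < r I v
    ℓ-range    : ∀ v → 1 ≤ ℓ I v × ℓ I v ≤ 2 * n
    r-range    : ∀ v → 1 ≤ r I v × r I v ≤ 2 * n
    ℓ-inj      : ∀ v w → ℓ I v ≡ ℓ I w → v ≡ w
    r-inj      : ∀ v w → r I v ≡ r I w → v ≡ w
    ℓ≢r        : ∀ v w → ℓ I v ≢ r I w
    proper     : ∀ v w → v ≢ w → ¬ (ℓ I w ≤ ℓ I v × r I v ≤ r I w)
    ℓ-ordered  : ∀ v w → toℕ v < toℕ w → ℓ I v < ℓ I w

Adj : ∀ {n} → Intervals n → Fin n → Fin n → Set
Adj I v w = v ≢ w × (ℓ I v ≤ r I w × ℓ I w ≤ r I v)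

InClosedNbhd : ∀ {n} → Intervals n → Fin n → Fin n → Set
InClosedNbhd I v w = w ≡ v Data.Sum.⊎ Adj I v w
  where import Data.Sum

data Reach {n} (I : Intervals n) : Fin n → Fin n → Set where
  here : ∀ {v} → Reach I v v
  step : ∀ {u v w} → Adj I u v → Reach I v w → Reach I u w

Connected : ∀ {n} → Intervals n → Set
Connected I = ∀ v w → Reach I v w

least : ∀ {n} → (Fin n → Bool) → Maybe (Fin n)
least {zero}  p = nothing
least {suc n} p = if p zero then just zero else Maybe.map suc (least (λ i → p (suc i)))

sv : ∀ {n} → Intervals n → Fin n → Maybe (Fin n)
sv I v = least (λ w → (ℓ I w ≤ᵇ ℓ I v) ∧ (ℓ I v ≤ᵇ r I w))

_==F_ : ∀ {n} → Fin n → Fin n → Bool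
a ==F b = does (a Fin.≟ b)

_==M_ : ∀ {n} → Maybe (Fin n) → Fin n → Bool
just a  ==M b = a ==F b
nothing ==M b = false

isRoot : ∀ {n} → Fin n → Bool
isRoot zero    = true
isRoot (suc _) = false

-- Since vertices are attached in increasing order, the children of x from left
-- to right are the non-root w with s_w = x, in increasing order.
children : ∀ {n} → Intervals n → Fin n → List (Fin n)
children I x = filterᵇ (λ w → not (isRoot w) ∧ (sv I w ==M x)) (allFin _)

isLeaf : ∀ {n} → Intervals n → Fin n → Bool
isLeaf I x with children I x
... | []    = true
... | _ ∷ _ = false

lastChild : ∀ {n} → Intervals n → Fin n → Maybe (Fin n)
lastChild I x = last (children I x)

bfs : ∀ {n} → Intervals n → ℕ → List (Fin n) → List (Fin n)
bfs I zero    q       = []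
bfs I (suc f) []      = []
bfs I (suc f) (x ∷ q) = x ∷ bfs I f (q ++ children I x)

bfsOrder : ∀ {n} → Intervals (suc n) → List (Fin (suc n))
bfsOrder {n} I = bfs I (suc n) (zero ∷ [])

prevInternal : ∀ {n} → Intervals (suc n) → Fin (suc n) → Maybe (Fin (suc n))
prevInternal I v =
  last (filterᵇ (λ x → not (isLeaf I x)) (takeWhileᵇ (λ x → not (x ==F v)) (bfsOrder I)))

module Submission where

-- The parent s_w of w is monotone in w, and by connectivity s_w < w for every w other than the
-- root. Hence the breadth-first traversal of T visits the vertices in label order, the children of
-- x are listed in label order, and prev_internal(v) is the largest internal vertex below v. Since
-- left and right endpoints are ordered alike, u₂ is the largest w with ℓ_w < r_v. If v has a child
-- a, then ℓ_a < r_v forces a ≤ u₂, which pins s_{u₂} = v, and every child w of v has ℓ_w < r_v,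
-- so u₂ is the last one. If v is a leaf, p = s_{u₂} lies strictly below v and is internal, while
-- every internal x < v has a child b with ℓ_b < r_x < r_v, so b ≤ u₂ and x = s_b ≤ p.

open import Data.Bool using (Bool; true; false; T; not; _∧_)
open import Data.Bool.Properties using (T-∧; T-not-≡)
open import Data.Empty using (⊥-elim)
open import Data.Fin using (Fin; zero; suc; toℕ; _≤_; _<_; _≟_)
import Data.Fin.Properties as Fin
open import Data.Fin.Properties using (≤∧≢⇒<; <⇒≢; <-cmp; toℕ-injective; toℕ-fromℕ<)
open import Data.List as List using (List; []; _∷_; _++_; filterᵇ; takeWhileᵇ; last; allFin)
open import Data.List.Membership.Propositional using (_∈_)
open import Data.List.Membership.Propositional.Properties
  using (∈-allFin; ∈-filter⁺; ∈-filter⁻; ∈-++⁺ˡ; ∈-++⁺ʳ; ∈-++⁻)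
open import Data.List.Relation.Unary.All as All using (All; []; _∷_)
open import Data.List.Relation.Unary.AllPairs using (AllPairs; []; _∷_)
import Data.List.Relation.Unary.AllPairs.Properties as AllPairs
open import Data.List.Relation.Unary.Any using (here; there)
open import Data.Maybe as Maybe using (just; _>>=_)
open import Data.Nat as ℕ using (ℕ; suc; _≤ᵇ_; z≤n; s≤s)
import Data.Nat.Properties as ℕ
open import Data.Product using (_×_; _,_; proj₁; proj₂; ∃-syntax)
open import Data.Sum as Sum using (_⊎_; inj₁; inj₂)
open import Data.Unit using (⊤)
open import Function using (id)
open import Function.Bundles using (Equivalence)
open import Relation.Binary using (tri<; tri≈; tri>)
open import Relation.Binary.PropositionalEquality
  using (_≡_; _≢_; refl; sym; trans; cong; subst; module ≡-Reasoning)
open import Relation.Nullary using (¬_; Dec; yes; no)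
open import Relation.Nullary.Decidable using (T?)

open import Defs

module _ {n : ℕ} where

  Ascending : List (Fin n) → Set
  Ascending = AllPairs _<_

  record Enumerates (P : Fin n → Set) (xs : List (Fin n)) : Set where
    field
      ascending : Ascending xs
      sound     : ∀ {w} → w ∈ xs → P w
      complete  : ∀ {w} → P w → w ∈ xs
  open Enumerates public

  ∉[] : ∀ {v} → ¬ (v ∈ List.[] {A = Fin n})
  ∉[] ()

  head-≤ : ∀ {x w xs} → Ascending (x ∷ xs) → w ∈ x ∷ xs → x ≤ w
  head-≤ _          (here refl) = ℕ.≤-refl
  head-≤ (x< ∷ _)   (there w∈)  = ℕ.<⇒≤ (All.lookup x< w∈)

  enumerates-[] : ∀ {P} → (∀ {w} → ¬ P w) → Enumerates P []
  enumerates-[] ¬P = record { ascending = [] ; sound = λ () ; complete = λ Pw → ⊥-elim (¬P Pw) }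

  enumerates-cong : ∀ {P Q xs} → (∀ {w} → P w → Q w) → (∀ {w} → Q w → P w) →
                    Enumerates P xs → Enumerates Q xs
  enumerates-cong P⇒Q Q⇒P e = record
    { ascending = ascending e ; sound = λ w∈ → P⇒Q (sound e w∈) ; complete = λ Qw → complete e (Q⇒P Qw) }

  allFin-enumerates : Enumerates (λ _ → ⊤) (allFin n)
  allFin-enumerates = record
    { ascending = AllPairs.tabulate⁺-< id ; sound = λ _ → _ ; complete = λ {w} _ → ∈-allFin w }

  filter-enumerates : ∀ {P xs} (p : Fin n → Bool) → Enumerates P xs →
                      Enumerates (λ w → P w × T (p w)) (filterᵇ p xs)
  filter-enumerates p e = record
    { ascending = AllPairs.filter⁺ (λ w → T? (p w)) (ascending e)
    ; sound     = λ w∈ → let w∈xs , pw = ∈-filter⁻ (λ w → T? (p w)) w∈ in sound e w∈xs , pw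
    ; complete  = λ (Pw , pw) → ∈-filter⁺ (λ w → T? (p w)) (complete e Pw) pw
    }

  enumerates-∷ : ∀ {P x xs} → P x → (∀ {w} → P w → x ≤ w) →
                 Enumerates (λ w → P w × x < w) xs → Enumerates P (x ∷ xs)
  enumerates-∷ {P} {x} {xs} Px x≤ e = record
    { ascending = All.tabulate (λ w∈ → proj₂ (sound e w∈)) ∷ ascending e
    ; sound     = λ { (here refl) → Px ; (there w∈) → proj₁ (sound e w∈) }
    ; complete  = λ {w} Pw → member (w ≟ x) Pw
    }
    where
    member : ∀ {w} → Dec (w ≡ x) → P w → w ∈ x ∷ xs
    member (yes refl) _  = here refl
    member (no w≢x)   Pw = there (complete e (Pw , ≤∧≢⇒< (x≤ Pw) (λ x≡w → w≢x (sym x≡w))))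

  enumerates-tail : ∀ {P x xs} → Enumerates P (x ∷ xs) → Enumerates (λ w → P w × x < w) xs
  enumerates-tail {x = x} {xs} e with ascending e
  ... | x< ∷ asc = record
    { ascending = asc
    ; sound     = λ w∈ → sound e (there w∈) , All.lookup x< w∈
    ; complete  = λ { (Pw , x<w) → tailmember (complete e Pw) x<w }
    }
    where
    tailmember : ∀ {w} → w ∈ x ∷ xs → x < w → w ∈ xs
    tailmember (here refl) x<x = ⊥-elim (ℕ.<-irrefl refl x<x)
    tailmember (there w∈) _ = w∈

  enumerates-++ : ∀ {P Q xs ys} → Enumerates P xs → Enumerates Q ys → (∀ {a b} → P a → Q b → a < b) →
                  Enumerates (λ w → P w ⊎ Q w) (xs ++ ys)
  enumerates-++ {xs = xs} e f P<Q = record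
    { ascending = AllPairs.++⁺ (ascending e) (ascending f)
                    (All.tabulate λ a∈ → All.tabulate λ b∈ → P<Q (sound e a∈) (sound f b∈))
    ; sound     = λ w∈ → Sum.map (sound e) (sound f) (∈-++⁻ xs w∈)
    ; complete  = λ { (inj₁ Pw) → ∈-++⁺ˡ (complete e Pw) ; (inj₂ Qw) → ∈-++⁺ʳ xs (complete f Qw) }
    }

  enumerates-head : ∀ {P x xs c} → Enumerates P (x ∷ xs) → P c → (∀ {w} → P w → c ≤ w) → x ≡ c
  enumerates-head e Pc c≤ = Fin.≤-antisym (head-≤ (ascending e) (complete e Pc)) (c≤ (sound e (here refl)))

  last-ascending : ∀ {c xs} → Ascending xs → c ∈ xs → All (_≤ c) xs → last xs ≡ just c
  last-ascending {xs = x ∷ []}     _              (here refl) _ = refl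
  last-ascending {xs = x ∷ y ∷ ys} ((x<y ∷ _) ∷ _)   (here refl) (_ ∷ y≤x ∷ _) =
    ⊥-elim (ℕ.<-irrefl refl (ℕ.<-≤-trans x<y y≤x))
  last-ascending {xs = x ∷ y ∷ ys} (_ ∷ asc) (there c∈) (_ ∷ ≤c) = last-ascending asc c∈ ≤c

  enumerates-last : ∀ {P xs c} → Enumerates P xs → P c → (∀ {w} → P w → w ≤ c) → last xs ≡ just c
  enumerates-last e Pc ≤c = last-ascending (ascending e) (complete e Pc) (All.tabulate λ w∈ → ≤c (sound e w∈))

  enumerates-takeWhile : ∀ {P xs v} → Enumerates P xs → P v →
                         Enumerates (λ w → P w × w < v) (takeWhileᵇ (λ x → not (x ==F v)) xs)
  enumerates-takeWhile {xs = []} e Pv = ⊥-elim (∉[] (complete e Pv))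
  enumerates-takeWhile {xs = x ∷ xs} {v} e Pv with x ≟ v
  ... | yes refl = enumerates-[] λ (Pw , w<x) →
    ℕ.<-irrefl refl (ℕ.<-≤-trans w<x (head-≤ (ascending e) (complete e Pw)))
  ... | no x≢v = enumerates-∷ (sound e (here refl) , x<v) (λ (Pw , _) → head-≤ (ascending e) (complete e Pw))
    (enumerates-cong (λ ((Pw , x<w) , w<v) → (Pw , w<v) , x<w) (λ ((Pw , w<v) , x<w) → (Pw , x<w) , w<v)
      (enumerates-takeWhile (enumerates-tail e) (Pv , x<v)))
    where
    x<v : x < v
    x<v = ≤∧≢⇒< (head-≤ (ascending e) (complete e Pv)) x≢v

==F⇒≡ : ∀ {n} {a b : Fin n} → T (a ==F b) → a ≡ b
==F⇒≡ {a = a} {b} t with a ≟ b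
... | yes a≡b = a≡b

≡⇒==F : ∀ {n} {a b : Fin n} → a ≡ b → T (a ==F b)
≡⇒==F {a = a} {b} a≡b with a ≟ b
... | yes _   = _
... | no a≢b = a≢b a≡b

nonzero-≤ : ∀ {n} {a b : Fin (ℕ.suc n)} → a ≢ zero → a ≤ b → b ≢ zero
nonzero-≤ a≢0 a≤b refl = a≢0 (toℕ-injective (ℕ.n≤0⇒n≡0 a≤b))

least-minimal : ∀ {n} (p : Fin n → Bool) {x} → T (p x) →
                ∃[ m ] least p ≡ just m × T (p m) × (∀ {y} → T (p y) → m ≤ y)
least-minimal {ℕ.suc n} p {x} px with p zero in p0
... | true = zero , refl , subst T (sym p0) _ , λ _ → z≤n
... | false with x
...   | zero = ⊥-elim (subst T p0 px)
...   | suc x′ with least-minimal (λ i → p (suc i)) px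
...     | m , least≡m , pm , m≤ = suc m , cong (Maybe.map suc) least≡m , pm , minimal
  where
  minimal : ∀ {y} → T (p y) → suc m ≤ y
  minimal {zero}  py = ⊥-elim (subst T p0 py)
  minimal {suc y} py = s≤s (m≤ py)

module Representation {n : ℕ} {I : Intervals n} (H : IsLabeledProperRep I) where
  open IsLabeledProperRep H

  ℓ-mono-≤ : ∀ {v w} → v ≤ w → ℓ I v ℕ.≤ ℓ I w
  ℓ-mono-≤ {v} {w} v≤w with v ≟ w
  ... | yes refl = ℕ.≤-refl
  ... | no v≢w   = ℕ.<⇒≤ (ℓ-ordered v w (≤∧≢⇒< v≤w v≢w))

  r-mono : ∀ {v w} → v < w → r I v ℕ.< r I w
  r-mono {v} {w} v<w = ℕ.≰⇒> λ rw≤rv →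
    proper w v (λ w≡v → <⇒≢ v<w (sym w≡v)) (ℕ.<⇒≤ (ℓ-ordered v w v<w) , rw≤rv)

  r-mono-≤ : ∀ {v w} → v ≤ w → r I v ℕ.≤ r I w
  r-mono-≤ {v} {w} v≤w with v ≟ w
  ... | yes refl = ℕ.≤-refl
  ... | no v≢w   = ℕ.<⇒≤ (r-mono (≤∧≢⇒< v≤w v≢w))

  ℓ<r-of-≤ : ∀ {v w} → ℓ I v ℕ.≤ r I w → ℓ I v ℕ.< r I w
  ℓ<r-of-≤ {v} {w} ℓv≤rw = ℕ.≤∧≢⇒< ℓv≤rw (ℓ≢r v w)

  Covers : Fin n → Fin n → Bool
  Covers w y = (ℓ I y ≤ᵇ ℓ I w) ∧ (ℓ I w ≤ᵇ r I y)

  covers⁺ : ∀ {w y} → ℓ I y ℕ.≤ ℓ I w → ℓ I w ℕ.≤ r I y → T (Covers w y)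
  covers⁺ ℓy≤ℓw ℓw≤ry = Equivalence.from T-∧ (ℕ.≤⇒≤ᵇ ℓy≤ℓw , ℕ.≤⇒≤ᵇ ℓw≤ry)

  covers⁻ : ∀ {w y} → T (Covers w y) → ℓ I y ℕ.≤ ℓ I w × ℓ I w ℕ.≤ r I y
  covers⁻ {w} {y} c = let a , b = Equivalence.to T-∧ c in ℕ.≤ᵇ⇒≤ _ _ a , ℕ.≤ᵇ⇒≤ _ _ b

  covers-self : ∀ w → T (Covers w w)
  covers-self w = covers⁺ ℕ.≤-refl (ℕ.<⇒≤ (ℓ<r w))

  private
    parent-spec : ∀ w → ∃[ s ] sv I w ≡ just s × T (Covers w s) × (∀ {y} → T (Covers w y) → s ≤ y)
    parent-spec w = least-minimal (Covers w) (covers-self w)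

  parent : Fin n → Fin n
  parent w = proj₁ (parent-spec w)

  sv≡parent : ∀ w → sv I w ≡ just (parent w)
  sv≡parent w = let _ , sv≡ , _ = parent-spec w in sv≡

  parent-covers : ∀ w → T (Covers w (parent w))
  parent-covers w = let _ , _ , covers , _ = parent-spec w in covers

  parent-minimal : ∀ {w y} → T (Covers w y) → parent w ≤ y
  parent-minimal {w} = let _ , _ , _ , minimal = parent-spec w in minimal

  ℓ<r-parent : ∀ w → ℓ I w ℕ.< r I (parent w)
  ℓ<r-parent w = ℓ<r-of-≤ (proj₂ (covers⁻ (parent-covers w)))

  parent-≤ : ∀ w → parent w ≤ w
  parent-≤ w = parent-minimal (covers-self w)

  r<ℓ-below-parent : ∀ {w y} → y < parent w → r I y ℕ.< ℓ I w
  r<ℓ-below-parent {w} y<pw = ℕ.≰⇒> λ ℓw≤ry →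
    ℕ.<⇒≱ y<pw (parent-minimal (covers⁺ (ℓ-mono-≤ (ℕ.<⇒≤ (ℕ.<-≤-trans y<pw (parent-≤ w)))) ℓw≤ry))

  parent-unique : ∀ {w x} → ℓ I w ℕ.< r I x → (∀ {y} → y < x → r I y ℕ.< ℓ I w) → parent w ≡ x
  parent-unique {w} {x} ℓw<rx r<ℓw with <-cmp (parent w) x
  ... | tri< pw<x _ _ = ⊥-elim (ℕ.<-asym (ℓ<r-parent w) (r<ℓw pw<x))
  ... | tri≈ _ pw≡x _ = pw≡x
  ... | tri> _ _ x<pw = ⊥-elim (ℕ.<-asym ℓw<rx (r<ℓ-below-parent x<pw))

  parent-mono : ∀ {v w} → v ≤ w → parent v ≤ parent w
  parent-mono {v} {w} v≤w = ℕ.≮⇒≥ λ pw<pv →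
    ℕ.<-asym (ℓ<r-parent w) (ℕ.<-≤-trans (r<ℓ-below-parent pw<pv) (ℓ-mono-≤ v≤w))

  reach-stays-below : ∀ {w} → (∀ {y} → y < w → r I y ℕ.< ℓ I w) →
                      ∀ {u t} → Reach I u t → u < w → t < w
  reach-stays-below r<ℓ here u<w = u<w
  reach-stays-below r<ℓ (step (_ , _ , ℓt≤ru) reach) u<w =
    reach-stays-below r<ℓ reach (ℕ.≰⇒> λ w≤t →
      ℕ.<-irrefl refl (ℕ.<-≤-trans (r<ℓ u<w) (ℕ.≤-trans (ℓ-mono-≤ w≤t) ℓt≤ru)))


  closedNbhd⇒ℓ<r : ∀ {v w} → InClosedNbhd I v w → ℓ I w ℕ.< r I v
  closedNbhd⇒ℓ<r {v} (inj₁ refl)             = ℓ<r v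
  closedNbhd⇒ℓ<r     (inj₂ (_ , _ , ℓw≤rv)) = ℓ<r-of-≤ ℓw≤rv

  ≤-largest-neighbour : ∀ {v u : Fin n} → (∀ w → InClosedNbhd I v w → w ≤ u) →
                        ∀ {w} → ℓ I w ℕ.< r I v → w ≤ u
  ≤-largest-neighbour {v} u-max {w} ℓw<rv with <-cmp w v
  ... | tri< w<v _ _  = ℕ.≤-trans (ℕ.<⇒≤ w<v) (u-max v (inj₁ refl))
  ... | tri≈ _ refl _ = u-max v (inj₁ refl)
  ... | tri> _ _ v<w  = u-max w (inj₂ ((<⇒≢ v<w) , ℕ.<⇒≤ (ℕ.<-trans (ℓ-ordered v w v<w) (ℓ<r w)) , ℕ.<⇒≤ ℓw<rv))

module Tree {n : ℕ} {I : Intervals (ℕ.suc n)} (H : IsLabeledProperRep I) where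
  open Representation H

  Child : Fin (ℕ.suc n) → Fin (ℕ.suc n) → Set
  Child x w = w ≢ zero × parent w ≡ x

  children-enumerates : ∀ x → Enumerates (Child x) (children I x)
  children-enumerates x =
    enumerates-cong (λ (_ , c) → child⁻ c) (λ c → _ , child⁺ c) (filter-enumerates _ allFin-enumerates)
    where
    nonroot⁻ : ∀ {w} → T (not (isRoot w)) → w ≢ zero
    nonroot⁻ {suc _} _ ()
    nonroot⁺ : ∀ {w} → w ≢ zero → T (not (isRoot w))
    nonroot⁺ {zero}  w≢0 = w≢0 refl
    nonroot⁺ {suc _} _   = _
    child⁻ : ∀ {w} → T (not (isRoot w) ∧ (sv I w ==M x)) → Child x w
    child⁻ {w} c = let nr , px = Equivalence.to T-∧ c in
      nonroot⁻ nr , ==F⇒≡ (subst (λ s → T (s ==M x)) (sv≡parent w) px)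
    child⁺ : ∀ {w} → Child x w → T (not (isRoot w) ∧ (sv I w ==M x))
    child⁺ {w} (w≢0 , px) = Equivalence.from T-∧
      (nonroot⁺ w≢0 , subst (λ s → T (s ==M x)) (sym (sv≡parent w)) (≡⇒==F px))

  isLeaf-false⇒child : ∀ {x} → isLeaf I x ≡ false → ∃[ w ] Child x w
  isLeaf-false⇒child {x} leaf with children I x | children-enumerates x
  ... | w ∷ _ | e = w , sound e (here refl)

  child⇒isLeaf-false : ∀ {x w} → Child x w → isLeaf I x ≡ false
  child⇒isLeaf-false {x} c with children I x | children-enumerates x
  ... | []    | e = ⊥-elim (∉[] (complete e c))
  ... | _ ∷ _ | _ = refl

  lastChild-≡ : ∀ {x c} → Child x c → (∀ {w} → Child x w → w ≤ c) → lastChild I x ≡ just c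
  lastChild-≡ {x} = enumerates-last (children-enumerates x)

  module _ (connected : Connected I) where

    parent-< : ∀ {w} → w ≢ zero → parent w < w
    parent-< {w} w≢0 with parent w ≟ w
    ... | no pw≢w  = ≤∧≢⇒< (parent-≤ w) pw≢w
    ... | yes pw≡w = ⊥-elim (ℕ.<-irrefl refl
            (reach-stays-below (λ y<w → r<ℓ-below-parent (Fin.<-respʳ-≡ (sym pw≡w) y<w))
                               (connected zero w) (nonzero w≢0)))
      where
      nonzero : ∀ {w : Fin (ℕ.suc n)} → w ≢ zero → 0 ℕ.< toℕ w
      nonzero {zero}  w≢0 = ⊥-elim (w≢0 refl)
      nonzero {suc _} _   = ℕ.z<s

    -- the BFS queue once the vertices 0, …, k-1 have been dequeued
    Frontier : ℕ → Fin (ℕ.suc n) → Set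
    Frontier k w = k ℕ.≤ toℕ w × (w ≡ zero ⊎ toℕ (parent w) ℕ.< k)

    frontier-self : ∀ {k x} → toℕ x ≡ k → Frontier k x
    frontier-self {x = zero}  refl = ℕ.≤-refl , inj₁ refl
    frontier-self {x = suc x} refl = ℕ.≤-refl , inj₂ (parent-< λ ())

    frontier-step : ∀ {k x q} → toℕ x ≡ k → Enumerates (Frontier k) (x ∷ q) →
                    Enumerates (Frontier (ℕ.suc k)) (q ++ children I x)
    frontier-step {k} {x} refl e =
      enumerates-cong into onto (enumerates-++ (enumerates-tail e) (children-enumerates x) separated)
      where
      separated : ∀ {a b} → Frontier k a × x < a → Child x b → a < b
      separated ((_ , inj₁ refl) , ())
      separated ((_ , inj₂ pa<x) , _) (_ , refl) = ℕ.≰⇒> λ b≤a → ℕ.<⇒≱ pa<x (parent-mono b≤a)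
      into : ∀ {w} → (Frontier k w × x < w) ⊎ Child x w → Frontier (ℕ.suc k) w
      into (inj₁ ((_ , root-or-below) , x<w)) = x<w , Sum.map₂ ℕ.m<n⇒m<1+n root-or-below
      into (inj₂ (w≢0 , refl))                = parent-< w≢0 , inj₂ ℕ.≤-refl
      onto : ∀ {w} → Frontier (ℕ.suc k) w → (Frontier k w × x < w) ⊎ Child x w
      onto (k<w , inj₁ w≡0) = inj₁ ((ℕ.<⇒≤ k<w , inj₁ w≡0) , k<w)
      onto {w} (k<w , inj₂ pw≤k) with ℕ.m≤n⇒m<n∨m≡n (ℕ.≤-pred pw≤k)
      ... | inj₁ pw<k = inj₁ ((ℕ.<⇒≤ k<w , inj₂ pw<k) , k<w)
      ... | inj₂ pw≡k = inj₂ ((λ { refl → ℕ.n≮0 k<w }) , toℕ-injective pw≡k)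

    bfs-enumerates : ∀ f k {q} → f ℕ.+ k ≡ ℕ.suc n → Enumerates (Frontier k) q →
                     Enumerates (λ w → k ℕ.≤ toℕ w) (bfs I f q)
    bfs-enumerates ℕ.zero k refl _ = enumerates-[] λ {w} k≤w → ℕ.<-irrefl refl (ℕ.<-≤-trans (Fin.toℕ<n w) k≤w)
    bfs-enumerates (ℕ.suc f) k {q} f+k≡n e = visit q e
      where
      k<n : k ℕ.< ℕ.suc n
      k<n = subst (k ℕ.<_) f+k≡n (ℕ.s≤s (ℕ.m≤n+m k f))
      visit : ∀ q → Enumerates (Frontier k) q → Enumerates (λ w → k ℕ.≤ toℕ w) (bfs I (ℕ.suc f) q)
      visit []      e = ⊥-elim (∉[] (complete e (frontier-self (toℕ-fromℕ< k<n))))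
      visit (x ∷ q) e = enumerates-∷ (proj₁ (sound e (here refl))) (λ k≤w → subst (ℕ._≤ _) (sym x≡k) k≤w)
        (enumerates-cong (λ k<w → ℕ.<⇒≤ k<w , subst (ℕ._< _) (sym x≡k) k<w)
                         (λ (_ , x<w) → subst (ℕ._< _) x≡k x<w)
          (bfs-enumerates f (ℕ.suc k) (trans (ℕ.+-suc f k) f+k≡n) (frontier-step x≡k e)))
        where
        x≡k : toℕ x ≡ k
        x≡k = trans (cong toℕ (enumerates-head e (frontier-self (toℕ-fromℕ< k<n))
                                 λ (k≤w , _) → subst (ℕ._≤ _) (sym (toℕ-fromℕ< k<n)) k≤w))
                    (toℕ-fromℕ< k<n)

    bfsOrder-enumerates : Enumerates (λ _ → ⊤) (bfsOrder I)
    bfsOrder-enumerates =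
      enumerates-cong _ (λ _ → ℕ.z≤n) (bfs-enumerates (ℕ.suc n) 0 (ℕ.+-identityʳ _) root-frontier)
      where
      root-frontier : Enumerates (Frontier 0) (zero ∷ [])
      root-frontier = record
        { ascending = [] ∷ []
        ; sound     = λ { (here refl) → ℕ.z≤n , inj₁ refl }
        ; complete  = λ { (_ , inj₁ refl) → here refl }
        }

    prevInternal-≡ : ∀ {v p a} → Child p a → p < v → (∀ {x b} → Child x b → x < v → x ≤ p) →
                     prevInternal I v ≡ just p
    prevInternal-≡ {v} {p} c p<v ≤p =
      enumerates-last (filter-enumerates _ (enumerates-takeWhile bfsOrder-enumerates _))
        ((_ , p<v) , Equivalence.from T-not-≡ (child⇒isLeaf-false c))
        λ ((_ , x<v) , internal) →
          let _ , cb = isLeaf-false⇒child (Equivalence.to T-not-≡ internal) in ≤p cb x<v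

module _ {m : ℕ} {I : Intervals (ℕ.suc (ℕ.suc m))} (H : IsLabeledProperRep I)
         {v u₂ : Fin (ℕ.suc (ℕ.suc m))} (u₂∈N[v] : InClosedNbhd I v u₂)
         (u₂-max : ∀ w → InClosedNbhd I v w → w ≤ u₂)
         where
  open Representation H
  open Tree H

  private
    ≤u₂ : ∀ {w} → ℓ I w ℕ.< r I v → w ≤ u₂
    ≤u₂ = ≤-largest-neighbour u₂-max

  lastChild-≡-u₂ : ∀ {x} → x ≤ v → Child x u₂ → lastChild I x ≡ just u₂
  lastChild-≡-u₂ x≤v c = lastChild-≡ c λ {w} (_ , pw≡x) →
    ≤u₂ (ℕ.<-≤-trans (ℓ<r-parent w) (r-mono-≤ (Fin.≤-trans (Fin.≤-reflexive pw≡x) x≤v)))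

  internal-case : isLeaf I v ≡ false → lastChild I v ≡ just u₂
  internal-case leaf with isLeaf-false⇒child leaf
  ... | a , a≢0 , pa≡v =
    lastChild-≡-u₂ Fin.≤-refl (nonzero-≤ a≢0 a≤u₂ , parent-unique (closedNbhd⇒ℓ<r u₂∈N[v]) r<ℓu₂)
    where
    a≤u₂ : a ≤ u₂
    a≤u₂ = ≤u₂ (subst (λ x → ℓ I a ℕ.< r I x) pa≡v (ℓ<r-parent a))
    r<ℓu₂ : ∀ {y} → y < v → r I y ℕ.< ℓ I u₂
    r<ℓu₂ y<v = ℕ.<-≤-trans (r<ℓ-below-parent (Fin.<-respʳ-≡ (sym pa≡v) y<v)) (ℓ-mono-≤ a≤u₂)

  leaf-case : Connected I → isLeaf I v ≡ true → (prevInternal I v >>= lastChild I) ≡ just u₂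
  leaf-case connected leaf = begin
      (prevInternal I v >>= lastChild I)
        ≡⟨ cong (_>>= lastChild I) (prevInternal-≡ connected u₂-child p<v internal-≤p) ⟩
      lastChild I p
        ≡⟨ lastChild-≡-u₂ (ℕ.<⇒≤ p<v) u₂-child ⟩
      just u₂
        ∎
    where
    open ≡-Reasoning
    p : Fin (ℕ.suc (ℕ.suc m))
    p = parent u₂
    childless : ∀ {w} → ¬ Child v w
    childless c with () ← trans (sym leaf) (child⇒isLeaf-false c)
    -- the graph has a vertex 1, whose parent is the root, so the root is not a leaf
    v≢0 : v ≢ zero
    v≢0 refl = childless ((λ ()) , toℕ-injective (ℕ.n<1⇒n≡0 (parent-< connected {suc zero} (λ ()))))
    u₂-child : Child p u₂
    u₂-child = nonzero-≤ v≢0 (u₂-max v (inj₁ refl)) , refl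
    p<v : p < v
    p<v = Fin.≤∧≢⇒< (ℕ.≮⇒≥ λ v<p → ℕ.<-asym (closedNbhd⇒ℓ<r u₂∈N[v]) (r<ℓ-below-parent v<p))
                    (λ p≡v → childless (proj₁ u₂-child , p≡v))
    internal-≤p : ∀ {x b} → Child x b → x < v → x ≤ p
    internal-≤p {x} {b} (_ , pb≡x) x<v = Fin.≤-trans (Fin.≤-reflexive (sym pb≡x))
      (parent-mono (≤u₂ (ℕ.<-trans (subst (λ y → ℓ I b ℕ.< r I y) pb≡x (ℓ<r-parent b)) (r-mono x<v))))

lemma11 : (m : ℕ) (I : Intervals (suc (suc m))) → IsLabeledProperRep I → Connected I →
          (v u₂ : Fin (suc (suc m))) →
          InClosedNbhd I v u₂ → (∀ w → InClosedNbhd I v w → w ≤ u₂) →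
          (isLeaf I v ≡ true → (prevInternal I v >>= lastChild I) ≡ just u₂) ×
          (isLeaf I v ≡ false → lastChild I v ≡ just u₂)
lemma11 m I H connected v u₂ u₂∈N[v] u₂-max =
  leaf-case H u₂∈N[v] u₂-max connected , internal-case H u₂∈N[v] u₂-max
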